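{- For every integer $n\geq 2$, $a_{(n^2-2,n,2)}((n+1)[n]) = 1 + a_{(n^2-2,n,2)}(n[n+1])$.
   Context: For a partition $\lambda$ and positive integers $d,n$, the plethysm coefficient $a_\lambda(d[n])$ is the coefficient of the Schur function $s_\lambda$ in the plethysm $h_d[h_n]$ of complete homogeneous symmetric functions; equivalently, the multiplicity of the irreducible $\mathsf{GL}_m$-representation of highest weight $\lambda$ in $\mathrm{Sym}^d(\mathrm{Sym}^n\mathbb{C}^m)$ for $m$ large. -}

module Defs where

open import Data.Nat as ℕ using (ℕ; zero; suc; _+_; _*_; _∸_; _^_; _≡ᵇ_)
open import Data.Integer as ℤ using (ℤ; +_; -_)
open import Data.Bool using (Bool; true; false; _∧_; if_then_else_)
open import Data.Product using (_×_; _,_; proj₁; proj₂)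
open import Data.Maybe using (Maybe; just; nothing)
open import Data.List using (List; []; _∷_; map; _++_; length; replicate; zipWith; foldr; concatMap; upTo; reverse)

-- We work with symmetric polynomials in
-- ℓ = length λ variables x_1 … x_ℓ, which determines the coefficient of s_λ.
-- Exponent vectors (monomials) are lists of naturals of length ℓ.

-- weak compositions of n into ℓ parts = monomials of h_n in ℓ variables
comps : ℕ → ℕ → List (List ℕ)
comps zero zero = [] ∷ []
comps zero (suc n) = []
comps (suc ℓ) n = concatMap (λ k → map (k ∷_) (comps ℓ (n ∸ k))) (upTo (suc n))

-- multisets of size d of elements of a list (as nondecreasing-index lists)
msets : {A : Set} → List A → ℕ → List (List A)
msets xs zero = [] ∷ []
msets [] (suc d) = []
msets (x ∷ xs) (suc d) = map (x ∷_) (msets (x ∷ xs) d) ++ msets xs (suc d)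

vsum : ℕ → List (List ℕ) → List ℕ
vsum ℓ = foldr (zipWith _+_) (replicate ℓ 0)

eqL : List ℕ → List ℕ → Bool
eqL [] [] = true
eqL (a ∷ as) (b ∷ bs) = (a ≡ᵇ b) ∧ eqL as bs
eqL _ _ = false

count : {A : Set} → (A → Bool) → List A → ℕ
count p [] = 0
count p (x ∷ xs) = if p x then suc (count p xs) else count p xs

-- Coefficient of the monomial x^α (α of length ℓ) in the plethysm h_d[h_n]
-- in ℓ variables: h_d[h_n] = h_d(monomials of h_n), so this is the number
-- of multisets of d monomials of degree n whose product is x^α.
plethMonCoeff : (ℓ d n : ℕ) → List ℕ → ℕ
plethMonCoeff ℓ d n α = count (λ m → eqL (vsum ℓ m) α) (msets (comps ℓ n) d)

-- Applied to the strictly decreasing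
-- list δ this gives exactly {(σ(δ), sgn σ) : σ ∈ S_ℓ}.
insS : ℤ → ℕ → List ℕ → List (List ℕ × ℤ)
insS s x [] = ((x ∷ []) , s) ∷ []
insS s x (y ∷ ys) = ((x ∷ y ∷ ys) , s) ∷ map (λ qt → (y ∷ proj₁ qt) , proj₂ qt) (insS (- s) x ys)

perms : List ℕ → List (List ℕ × ℤ)
perms [] = ([] , + 1) ∷ []
perms (x ∷ xs) = concatMap (λ ps → insS (proj₂ ps) x (proj₁ ps)) (perms xs)

subL : List ℕ → List ℕ → Maybe (List ℕ)
subL [] [] = just []
subL (a ∷ as) (b ∷ bs) with b ℕ.≤ᵇ a
... | false = nothing
... | true with subL as bs
...   | nothing = nothing
...   | just cs = just ((a ∸ b) ∷ cs)
subL _ _ = nothing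

staircase : ℕ → List ℕ
staircase ℓ = reverse (upTo ℓ)

-- Coefficient of s_λ in a symmetric polynomial f in ℓ = length λ variables
-- with monomial coefficients c : (List ℕ → ℕ):
--   [s_λ] f = [x^(λ+δ)] (a_δ · f) = Σ_{σ ∈ S_ℓ} sgn σ · [x^(λ+δ-σ(δ))] f
schurCoeff : (c : List ℕ → ℕ) → List ℕ → ℤ
schurCoeff c λ′ = foldr ℤ._+_ (+ 0) (map term (perms δ))
  where
  ℓ = length λ′
  δ = staircase ℓ
  term : List ℕ × ℤ → ℤ
  term (π , s) with subL (zipWith _+_ λ′ δ) π
  ... | nothing = + 0
  ... | just α = s ℤ.* (+ c α)

plethCoeff : List ℕ → ℕ → ℕ → ℤ
plethCoeff λ′ d n = schurCoeff (plethMonCoeff (length λ′) d n) λ′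

{-# OPTIONS --safe #-}

-- Write N = 2 + k.  In three variables the coefficient of s_λ, λ = (N² − 2, N, 2), in a symmetric
-- polynomial is the alternating sum of its coefficients at the six monomials x^(λ + δ − σδ), σ ∈ S₃.
-- The coefficient of x^α in h_{N+1}[h_N] counts multisets of N + 1 monomials of degree N with product
-- x^α; those containing x₁ᴺ correspond, by removing one copy of it, to multisets of N such monomials
-- with product x^α / x₁ᴺ.  The coefficient of x^α in h_N[h_{N+1}] counts multisets of N monomials of
-- degree N + 1; those consisting of multiples of x₁ correspond, by dividing each by x₁, to the same
-- multisets.  The remaining multisets (the excesses) are few at the six targets, whose degree in x₂, x₃
-- is at most N + 2: on the left every monomial other than x₁ᴺ has degree at least 1 in x₂, x₃, on the
-- right an x₁-free monomial already has degree N + 1.  Counting them gives (3, 1, 1, 2, 0, 0) on the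
-- left and (2, 1, 1, 2, 0, 0) on the right; they differ only at σ = id.

module Submission where

open import Defs

-- ℕ's _+_ is kept local to this module, since the statement of theorem5 uses ℤ's.
module _ where

  open import Data.Bool using (Bool; true; false; if_then_else_; _∧_)
  open import Data.Bool.Properties using (∧-identityʳ)
  open import Data.Integer as ℤ using (ℤ; _⊖_; 0ℤ; 1ℤ; -1ℤ)
  open import Data.Integer.Properties using ([+m]-[+n]≡m⊖n; pos-+; distribʳ-⊖-+-pos)
  open import Data.Integer.Tactic.RingSolver using () renaming (solve-∀ to ℤ-solve-∀)
  open import Data.List using (List; []; _∷_; _++_; [_]; map; foldr; zipWith; upTo; applyUpTo; concatMap)
  open import Data.List.Properties
    using (map-∘; map-++; ++-assoc; ++-identityʳ; upTo-∷ʳ; map-upTo; concatMap-++; concatMap-cong;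
           concatMap-map; concatMap-pure; map-concatMap)
  open import Data.List.Relation.Unary.All as All using (All; []; _∷_)
  open import Data.List.Relation.Unary.All.Properties using (all-upTo; map⁺; concat⁺; ++⁺)
  open import Data.Nat as ℕ using (ℕ; zero; suc; _+_; _*_; _∸_; _≤_; _<_; z≤n; s≤s; s≤s⁻¹; z<s; _≡ᵇ_)
  open import Data.Nat.Properties hiding (_≟_)
  open import Algebra.Properties.CommutativeSemigroup +-commutativeSemigroup
    using (interchange; x∙yz≈xz∙y; x∙yz≈y∙xz; x∙yz≈y∙zx; xy∙z≈xz∙y)
  open import Data.Nat.Tactic.RingSolver using (solve-∀)
  open import Data.Product using (_,_)
  open import Function using (_∘_)
  open import Relation.Binary.Definitions using (DecidableEquality)
  open import Relation.Binary.PropositionalEquality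
    using (_≡_; refl; sym; trans; cong; cong₂; subst; subst₂; _≗_; module ≡-Reasoning)
  open import Relation.Nullary using (¬_; does; map′; _×-dec_; contradiction)
  open import Relation.Nullary.Decidable using (dec-true; dec-false)

  record Mon : Set where
    constructor ⟨_,_,_⟩
    field e₁ e₂ e₃ : ℕ
  open Mon

  infixl 6 _⊕_
  infixr 7 _⊛_
  infix 4 _≟_

  _⊕_ : Mon → Mon → Mon
  x ⊕ y = ⟨ e₁ x + e₁ y , e₂ x + e₂ y , e₃ x + e₃ y ⟩

  _⊛_ : ℕ → Mon → Mon
  d ⊛ x = ⟨ d * e₁ x , d * e₂ x , d * e₃ x ⟩

  𝟘 : Mon
  𝟘 = ⟨ 0 , 0 , 0 ⟩

  x₁^_ : ℕ → Mon
  x₁^ n = ⟨ n , 0 , 0 ⟩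

  x₁·_ : Mon → Mon
  x₁· x = ⟨ suc (e₁ x) , e₂ x , e₃ x ⟩

  Mon-≡ : ∀ {a b c a′ b′ c′} → a ≡ a′ → b ≡ b′ → c ≡ c′ → ⟨ a , b , c ⟩ ≡ ⟨ a′ , b′ , c′ ⟩
  Mon-≡ refl refl refl = refl

  _≟_ : DecidableEquality Mon
  x ≟ y = map′ (λ (p , q , r) → Mon-≡ p q r) (λ { refl → refl , refl , refl })
    (e₁ x ℕ.≟ e₁ y ×-dec e₂ x ℕ.≟ e₂ y ×-dec e₃ x ℕ.≟ e₃ y)

  ⊕-identityʳ : ∀ x → x ⊕ 𝟘 ≡ x
  ⊕-identityʳ x = Mon-≡ (+-identityʳ _) (+-identityʳ _) (+-identityʳ _)

  ⊕-comm : ∀ x y → x ⊕ y ≡ y ⊕ x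
  ⊕-comm x y = Mon-≡ (+-comm (e₁ x) (e₁ y)) (+-comm (e₂ x) (e₂ y)) (+-comm (e₃ x) (e₃ y))

  ⊕-assoc : ∀ x y z → x ⊕ y ⊕ z ≡ x ⊕ (y ⊕ z)
  ⊕-assoc x y z = Mon-≡ (+-assoc (e₁ x) _ _) (+-assoc (e₂ x) _ _) (+-assoc (e₃ x) _ _)

  ⊕-swapʳ : ∀ β x y → β ⊕ x ⊕ y ≡ β ⊕ y ⊕ x
  ⊕-swapʳ β x y =
    Mon-≡ (xy∙z≈xz∙y (e₁ β) (e₁ x) (e₁ y)) (xy∙z≈xz∙y (e₂ β) (e₂ x) (e₂ y)) (xy∙z≈xz∙y (e₃ β) (e₃ x) (e₃ y))

  -- Counting multisets of monomials by their product

  -- ways L d β α is the number of multisets of d elements of L whose sum, added to β, is α.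
  ways : List Mon → ℕ → Mon → Mon → ℕ
  ways L       zero    β α = if does (β ≟ α) then 1 else 0
  ways []      (suc d) β α = 0
  ways (x ∷ L) (suc d) β α = ways (x ∷ L) d (β ⊕ x) α + ways L (suc d) β α

  ways-zero-≡ : ∀ L {β α} → β ≡ α → ways L 0 β α ≡ 1
  ways-zero-≡ L {β} {α} β≡α rewrite dec-true (β ≟ α) β≡α = refl

  ways-zero-≢ : ∀ L {β α} → ¬ β ≡ α → ways L 0 β α ≡ 0
  ways-zero-≢ L {β} {α} β≢α rewrite dec-false (β ≟ α) β≢α = refl

  ways-singleton : ∀ x d β α → α ≡ β ⊕ d ⊛ x → ways (x ∷ []) d β α ≡ 1
  ways-singleton x zero    β α eq = ways-zero-≡ (x ∷ []) (sym (trans eq (⊕-identityʳ β)))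
  ways-singleton x (suc d) β α eq =
    trans (+-identityʳ _) (ways-singleton x d (β ⊕ x) α (trans eq (sym (⊕-assoc β x (d ⊛ x)))))

  ways-map-x₁· : ∀ L d β α → ways (map x₁·_ L) d β α ≡ ways L d (x₁^ d ⊕ β) α
  ways-map-x₁· L       zero    β α = refl
  ways-map-x₁· []      (suc d) β α = refl
  ways-map-x₁· (x ∷ L) (suc d) β α = cong₂ _+_
    (trans (ways-map-x₁· (x ∷ L) d (β ⊕ x₁· x) α) (cong (λ γ → ways (x ∷ L) d γ α) shuffle))
    (ways-map-x₁· L (suc d) β α)
    where
    suc-shuffle : ∀ a b c → a + (b + suc c) ≡ suc a + b + c
    suc-shuffle = solve-∀
    shuffle : x₁^ d ⊕ (β ⊕ x₁· x) ≡ x₁^ suc d ⊕ β ⊕ x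
    shuffle = Mon-≡ (suc-shuffle d (e₁ β) (e₁ x)) refl refl

  ways-∷ʳ : ∀ z L d β α →
            ways (L ++ z ∷ []) (suc d) β α ≡ ways (L ++ z ∷ []) d (β ⊕ z) α + ways L (suc d) β α
  ways-∷ʳ z []      d       β α = refl
  ways-∷ʳ z (x ∷ L) zero    β α =
    trans (cong (ways (x ∷ L ++ z ∷ []) 0 (β ⊕ x) α +_) (ways-∷ʳ z L 0 β α))
          (x∙yz≈y∙xz (ways (x ∷ L ++ z ∷ []) 0 (β ⊕ x) α) (ways (L ++ z ∷ []) 0 (β ⊕ z) α) (ways L 1 β α))
  ways-∷ʳ z (x ∷ L) (suc d) β α = begin
    ways (x ∷ L ++ z ∷ []) (suc d) (β ⊕ x) α + ways (L ++ z ∷ []) (suc (suc d)) β α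
      ≡⟨ cong₂ _+_ (ways-∷ʳ z (x ∷ L) d (β ⊕ x) α) (ways-∷ʳ z L (suc d) β α) ⟩
    (ways (x ∷ L ++ z ∷ []) d (β ⊕ x ⊕ z) α + ways (x ∷ L) (suc d) (β ⊕ x) α)
      + (ways (L ++ z ∷ []) (suc d) (β ⊕ z) α + ways L (suc (suc d)) β α)
      ≡⟨ cong (λ γ → ways (x ∷ L ++ z ∷ []) d γ α + ways (x ∷ L) (suc d) (β ⊕ x) α
                       + (ways (L ++ z ∷ []) (suc d) (β ⊕ z) α + ways L (suc (suc d)) β α))
              (⊕-swapʳ β x z) ⟩
    (ways (x ∷ L ++ z ∷ []) d (β ⊕ z ⊕ x) α + ways (x ∷ L) (suc d) (β ⊕ x) α)
      + (ways (L ++ z ∷ []) (suc d) (β ⊕ z) α + ways L (suc (suc d)) β α)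
      ≡⟨ interchange (ways (x ∷ L ++ z ∷ []) d (β ⊕ z ⊕ x) α) (ways (x ∷ L) (suc d) (β ⊕ x) α)
                     (ways (L ++ z ∷ []) (suc d) (β ⊕ z) α) (ways L (suc (suc d)) β α) ⟩
    ways (x ∷ L ++ z ∷ []) (suc d) (β ⊕ z) α + ways (x ∷ L) (suc (suc d)) β α ∎
    where open ≡-Reasoning

  -- Weight bounds

  Additive : (Mon → ℕ) → Set
  Additive w = ∀ x y → w (x ⊕ y) ≡ w x + w y

  -- Summed in this order so that it computes on the targets below, whose x₃-exponents are numerals.
  e₂₃ : Mon → ℕ
  e₂₃ x = e₃ x + e₂ x

  e₂₃-additive : Additive e₂₃
  e₂₃-additive x y = interchange (e₃ x) (e₃ y) (e₂ x) (e₂ y)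

  module Weight (w : Mon → ℕ) (w-⊕ : Additive w) where

    w+d*0 : ∀ d β → w β + d * 0 ≡ w β
    w+d*0 d β = trans (cong (w β +_) (*-zeroʳ d)) (+-identityʳ (w β))

    w-⊕-+ : ∀ β x n → w (β ⊕ x) + n ≡ w β + (w x + n)
    w-⊕-+ β x n = trans (cong (_+ n) (w-⊕ β x)) (+-assoc (w β) (w x) n)

    ways-tooHeavy : ∀ {m} L → All (λ x → m ≤ w x) L →
                    ∀ d β α → w α < w β + d * m → ways L d β α ≡ 0
    ways-tooHeavy L _ zero β α α<β = ways-zero-≢ L λ β≡α →
      <-irrefl (sym (cong w β≡α)) (subst (w α <_) (+-identityʳ (w β)) α<β)
    ways-tooHeavy [] _ (suc d) β α _ = refl
    ways-tooHeavy {m} (x ∷ L) (m≤x ∷ m≤L) (suc d) β α α<β =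
      cong₂ _+_ (ways-tooHeavy (x ∷ L) (m≤x ∷ m≤L) d (β ⊕ x) α (<-≤-trans α<β step))
                (ways-tooHeavy L m≤L (suc d) β α α<β)
      where
      step : w β + suc d * m ≤ w (β ⊕ x) + d * m
      step = subst (w β + suc d * m ≤_) (sym (w-⊕-+ β x (d * m)))
                   (+-monoʳ-≤ (w β) (+-monoˡ-≤ (d * m) m≤x))

    ways-tooLight : ∀ {M} L → All (λ x → w x ≤ M) L →
                    ∀ d β α → w β + d * M < w α → ways L d β α ≡ 0
    ways-tooLight L _ zero β α β<α = ways-zero-≢ L λ β≡α →
      <-irrefl (cong w β≡α) (subst (_< w α) (+-identityʳ (w β)) β<α)
    ways-tooLight [] _ (suc d) β α _ = refl
    ways-tooLight {M} (x ∷ L) (x≤M ∷ L≤M) (suc d) β α β<α =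
      cong₂ _+_ (ways-tooLight (x ∷ L) (x≤M ∷ L≤M) d (β ⊕ x) α (≤-<-trans step β<α))
                (ways-tooLight L L≤M (suc d) β α β<α)
      where
      step : w (β ⊕ x) + d * M ≤ w β + suc d * M
      step = subst (_≤ w β + suc d * M) (sym (w-⊕-+ β x (d * M)))
                   (+-monoʳ-≤ (w β) (+-monoˡ-≤ (d * M) x≤M))

    ways-belowStart : ∀ L d β α → w α < w β → ways L d β α ≡ 0
    ways-belowStart L d β α α<β = ways-tooHeavy {0} L (All.universal (λ _ → z≤n) L) d β α
      (subst (w α <_) (sym (w+d*0 d β)) α<β)

    ways-aboveStart : ∀ L → All (λ x → w x ≤ 0) L → ∀ d β α → w β < w α → ways L d β α ≡ 0
    ways-aboveStart L L≤0 d β α β<α = ways-tooLight {0} L L≤0 d β α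
      (subst (_< w α) (sym (w+d*0 d β)) β<α)

    ways-++-dropHeavy : ∀ {m t} A B → All (λ x → t < w x) A → All (λ x → m ≤ w x) (A ++ B) →
                        ∀ d β α → w α ≤ w β + d * m + t → ways (A ++ B) (suc d) β α ≡ ways B (suc d) β α
    ways-++-dropHeavy [] B _ _ d β α _ = refl
    ways-++-dropHeavy {m} {t} (x ∷ A) B (t<x ∷ t<A) (m≤x ∷ m≤AB) d β α α≤ =
      cong₂ _+_ (ways-tooHeavy (x ∷ A ++ B) (m≤x ∷ m≤AB) d (β ⊕ x) α (≤-<-trans α≤ step))
                (ways-++-dropHeavy A B t<A m≤AB d β α α≤)
      where
      step : w β + d * m + t < w (β ⊕ x) + d * m
      step = subst₂ _<_ (x∙yz≈xz∙y (w β) t (d * m)) (sym (w-⊕-+ β x (d * m)))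
                   (+-monoʳ-< (w β) (+-monoˡ-< (d * m) t<x))

    ways-++-dropHeavy₀ : ∀ {t} A B → All (λ x → t < w x) A →
                         ∀ d β α → w α ≤ t + w β → ways (A ++ B) (suc d) β α ≡ ways B (suc d) β α
    ways-++-dropHeavy₀ {t} A B t<A d β α α≤ =
      ways-++-dropHeavy {0} A B t<A (All.universal (λ _ → z≤n) (A ++ B)) d β α
        (subst (w α ≤_) (trans (+-comm t (w β)) (cong (_+ t) (sym (w+d*0 d β)))) α≤)

    -- The hypothesis says w α < w (β ⊕ z) + (d − 1) m, with m added on both sides to avoid truncation.
    ways-∷ʳ-dropHeavy : ∀ {m} L z → All (λ x → m ≤ w x) (L ++ z ∷ []) →
                        ∀ d β α → w α + m < w (β ⊕ z) + d * m → ways (L ++ z ∷ []) d β α ≡ ways L d β α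
    ways-∷ʳ-dropHeavy L z m≤Lz zero    β α _ = refl
    ways-∷ʳ-dropHeavy {m} L z m≤Lz (suc d) β α α< = begin
      ways (L ++ z ∷ []) (suc d) β α                           ≡⟨ ways-∷ʳ z L d β α ⟩
      ways (L ++ z ∷ []) d (β ⊕ z) α + ways L (suc d) β α      ≡⟨ cong (_+ ways L (suc d) β α) overshoot ⟩
      ways L (suc d) β α                                       ∎
      where
      open ≡-Reasoning
      overshoot : ways (L ++ z ∷ []) d (β ⊕ z) α ≡ 0
      overshoot = ways-tooHeavy (L ++ z ∷ []) m≤Lz d (β ⊕ z) α
        (+-cancelʳ-< m (w α) _ (subst (w α + m <_) (x∙yz≈xz∙y (w (β ⊕ z)) m (d * m)) α<))

  module E₁ = Weight e₁ (λ _ _ → refl)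
  module E₂ = Weight e₂ (λ _ _ → refl)
  module E₃ = Weight e₃ (λ _ _ → refl)
  module E₂₃ = Weight e₂₃ e₂₃-additive

  -- Monomials of a fixed degree, row by row

  row : ℕ → ℕ → List Mon
  row a r = map (λ j → ⟨ a , j , r ∸ j ⟩) (upTo (suc r))

  rows : ℕ → ℕ → List Mon
  rows n m = concatMap (λ a → row a (n ∸ a)) (upTo m)

  monomials : ℕ → List Mon
  monomials n = rows n (suc n)

  -- row p 1 lists x₁ᵖx₃ and x₁ᵖx₂, so only i copies of the first and j of the second fit.
  ways-row₁ : ∀ p i j β α → α ≡ β ⊕ ⟨ (i + j) * p , j , i ⟩ → ways (row p 1) (i + j) β α ≡ 1
  ways-row₁ p zero    zero    β α eq = ways-zero-≡ (row p 1) (sym (trans eq (⊕-identityʳ β)))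
  ways-row₁ p zero    (suc j) β α eq = cong₂ _+_ noRoomForX₃ onlyX₂
    where
    noRoomForX₃ : ways (row p 1) j (β ⊕ ⟨ p , 0 , 1 ⟩) α ≡ 0
    noRoomForX₃ = E₃.ways-belowStart (row p 1) j (β ⊕ ⟨ p , 0 , 1 ⟩) α
      (subst (_< e₃ β + 1) (sym (cong e₃ eq)) (+-monoʳ-< (e₃ β) z<s))
    onlyX₂ : ways (⟨ p , 1 , 0 ⟩ ∷ []) (suc j) β α ≡ 1
    onlyX₂ = ways-singleton _ (suc j) β α
      (trans eq (cong (β ⊕_) (Mon-≡ refl (sym (*-identityʳ (suc j))) (sym (*-zeroʳ (suc j))))))
  ways-row₁ p (suc i) j β α eq = cong₂ _+_
    (ways-row₁ p i j (β ⊕ ⟨ p , 0 , 1 ⟩) α (trans eq (sym (⊕-assoc β _ _))))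
    x₃Unreachable
    where
    x₃Unreachable : ways (⟨ p , 1 , 0 ⟩ ∷ []) (suc (i + j)) β α ≡ 0
    x₃Unreachable = E₃.ways-aboveStart (⟨ p , 1 , 0 ⟩ ∷ []) (z≤n ∷ []) (suc (i + j)) β α
      (subst (e₃ β <_) (sym (cong e₃ eq)) (m<m+n (e₃ β) z<s))

  -- The degree in x₂, x₃ forces exactly r copies of the appended x₁ᵖ⁺¹.
  ways-row₁-∷ʳ : ∀ p i j r β α → α ≡ ⟨ (i + j) * p + r * suc p , j , i ⟩ ⊕ β →
                 ways (row p 1 ++ x₁^ suc p ∷ []) (i + j + r) β α ≡ 1
  ways-row₁-∷ʳ p i j zero β α eq = begin
    ways (row p 1 ++ x₁^ suc p ∷ []) (i + j + 0) β α
      ≡⟨ cong (λ d → ways (row p 1 ++ x₁^ suc p ∷ []) d β α) (+-identityʳ (i + j)) ⟩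
    ways (row p 1 ++ x₁^ suc p ∷ []) (i + j) β α
      ≡⟨ E₁.ways-∷ʳ-dropHeavy (row p 1) (x₁^ suc p) (≤-refl ∷ ≤-refl ∷ n≤1+n p ∷ []) (i + j) β α overshoot ⟩
    ways (row p 1) (i + j) β α
      ≡⟨ ways-row₁ p i j β α (trans eq (trans (cong (_⊕ β) (Mon-≡ (+-identityʳ _) refl refl)) (⊕-comm _ β)))
       ⟩
    1 ∎
    where
    open ≡-Reasoning
    bound : ∀ b q p → suc (q + 0 + b + p) ≡ b + suc p + q
    bound = solve-∀
    overshoot : e₁ α + p < e₁ β + suc p + (i + j) * p
    overshoot = subst (λ a → a + p < e₁ β + suc p + (i + j) * p) (sym (cong e₁ eq))
                      (≤-reflexive (bound (e₁ β) ((i + j) * p) p))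
  ways-row₁-∷ʳ p i j (suc r) β α eq = begin
    ways (row p 1 ++ x₁^ suc p ∷ []) (i + j + suc r) β α
      ≡⟨ cong (λ d → ways (row p 1 ++ x₁^ suc p ∷ []) d β α) (+-suc (i + j) r) ⟩
    ways (row p 1 ++ x₁^ suc p ∷ []) (suc (i + j + r)) β α
      ≡⟨ ways-∷ʳ (x₁^ suc p) (row p 1) (i + j + r) β α ⟩
    ways (row p 1 ++ x₁^ suc p ∷ []) (i + j + r) (β ⊕ x₁^ suc p) α + ways (row p 1) (suc (i + j + r)) β α
      ≡⟨ cong₂ _+_ (ways-row₁-∷ʳ p i j r (β ⊕ x₁^ suc p) α eq′) tooMany ⟩
    1 ∎
    where
    open ≡-Reasoning
    move-x₁ : ∀ q s t b → q + (s + t) + b ≡ q + t + (b + s)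
    move-x₁ = solve-∀
    eq′ : α ≡ ⟨ (i + j) * p + r * suc p , j , i ⟩ ⊕ (β ⊕ x₁^ suc p)
    eq′ = trans eq (Mon-≡ (move-x₁ ((i + j) * p) (suc p) (r * suc p) (e₁ β))
                          (cong (j +_) (sym (+-identityʳ (e₂ β)))) (cong (i +_) (sym (+-identityʳ (e₃ β)))))
    bound : ∀ b c i j r → suc (i + c + (j + b)) + r ≡ c + b + suc (i + j + r) * 1
    bound = solve-∀
    tooMany : ways (row p 1) (suc (i + j + r)) β α ≡ 0
    tooMany = E₂₃.ways-tooHeavy (row p 1) (≤-refl ∷ ≤-refl ∷ []) (suc (i + j + r)) β α
      (subst (_< e₂₃ β + suc (i + j + r) * 1) (sym (cong e₂₃ eq))
             (m+n≤o⇒m≤o _ (≤-reflexive (bound (e₂ β) (e₃ β) i j r))))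

  -- The monomial coefficients of a plethysm as multiset counts

  toList : Mon → List ℕ
  toList x = e₁ x ∷ e₂ x ∷ e₃ x ∷ []

  ∑ : List Mon → Mon
  ∑ = foldr _⊕_ 𝟘

  eqL-toList : ∀ x y → eqL (toList x) (toList y) ≡ does (x ≟ y)
  eqL-toList x y = cong (λ b → (e₁ x ≡ᵇ e₁ y) ∧ ((e₂ x ≡ᵇ e₂ y) ∧ b)) (∧-identityʳ (e₃ x ≡ᵇ e₃ y))

  vsum-toList : ∀ m → vsum 3 (map toList m) ≡ toList (∑ m)
  vsum-toList []      = refl
  vsum-toList (x ∷ m) = cong (zipWith _+_ (toList x)) (vsum-toList m)

  count-++ : ∀ {A : Set} (p : A → Bool) xs ys → count p (xs ++ ys) ≡ count p xs + count p ys
  count-++ p []       ys = refl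
  count-++ p (x ∷ xs) ys with p x
  ... | true  = cong suc (count-++ p xs ys)
  ... | false = count-++ p xs ys

  count-map : ∀ {A B : Set} (p : B → Bool) (f : A → B) xs → count p (map f xs) ≡ count (p ∘ f) xs
  count-map p f []       = refl
  count-map p f (x ∷ xs) with p (f x)
  ... | true  = cong suc (count-map p f xs)
  ... | false = count-map p f xs

  count-cong : ∀ {A : Set} {p q : A → Bool} → p ≗ q → count p ≗ count q
  count-cong p≗q []       = refl
  count-cong {q = q} p≗q (x ∷ xs) rewrite p≗q x with q x
  ... | true  = cong suc (count-cong p≗q xs)
  ... | false = count-cong p≗q xs

  msets-map : ∀ {A B : Set} (f : A → B) xs d → msets (map f xs) d ≡ map (map f) (msets xs d)
  msets-map f xs       zero    = refl
  msets-map f []       (suc d) = refl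
  msets-map f (x ∷ xs) (suc d) = begin
    map (f x ∷_) (msets (map f (x ∷ xs)) d) ++ msets (map f xs) (suc d)
      ≡⟨ cong₂ _++_ (cong (map (f x ∷_)) (msets-map f (x ∷ xs) d)) (msets-map f xs (suc d)) ⟩
    map (f x ∷_) (map (map f) (msets (x ∷ xs) d)) ++ map (map f) (msets xs (suc d))
      ≡⟨ cong (_++ _) (trans (sym (map-∘ (msets (x ∷ xs) d))) (map-∘ (msets (x ∷ xs) d))) ⟩
    map (map f) (map (x ∷_) (msets (x ∷ xs) d)) ++ map (map f) (msets xs (suc d))
      ≡⟨ sym (map-++ (map f) (map (x ∷_) (msets (x ∷ xs) d)) _) ⟩
    map (map f) (map (x ∷_) (msets (x ∷ xs) d) ++ msets xs (suc d)) ∎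
    where open ≡-Reasoning

  count-msets : ∀ L d β α → count (λ m → does (β ⊕ ∑ m ≟ α)) (msets L d) ≡ ways L d β α
  count-msets L       zero    β α = cong (λ γ → if does (γ ≟ α) then 1 else 0) (⊕-identityʳ β)
  count-msets []      (suc d) β α = refl
  count-msets (x ∷ L) (suc d) β α = begin
    count p (map (x ∷_) (msets (x ∷ L) d) ++ msets L (suc d))
      ≡⟨ count-++ p (map (x ∷_) (msets (x ∷ L) d)) _ ⟩
    count p (map (x ∷_) (msets (x ∷ L) d)) + count p (msets L (suc d))
      ≡⟨ cong (_+ count p (msets L (suc d))) (count-map p (x ∷_) (msets (x ∷ L) d)) ⟩
    count (p ∘ (x ∷_)) (msets (x ∷ L) d) + count p (msets L (suc d))
      ≡⟨ cong (_+ count p (msets L (suc d)))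
              (count-cong (λ m → cong (λ γ → does (γ ≟ α)) (sym (⊕-assoc β x (∑ m)))) (msets (x ∷ L) d)) ⟩
    count (λ m → does (β ⊕ x ⊕ ∑ m ≟ α)) (msets (x ∷ L) d) + count p (msets L (suc d))
      ≡⟨ cong₂ _+_ (count-msets (x ∷ L) d (β ⊕ x) α) (count-msets L (suc d) β α) ⟩
    ways (x ∷ L) d (β ⊕ x) α + ways L (suc d) β α ∎
    where
    open ≡-Reasoning
    p : List Mon → Bool
    p m = does (β ⊕ ∑ m ≟ α)

  concatMap-≡[] : ∀ {A B : Set} (f : A → List B) {xs} → All (λ x → f x ≡ []) xs → concatMap f xs ≡ []
  concatMap-≡[] f []              = refl
  concatMap-≡[] f (fx≡[] ∷ fxs≡[]) = cong₂ _++_ fx≡[] (concatMap-≡[] f fxs≡[])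

  comps-1 : ∀ s → comps 1 s ≡ (s ∷ []) ∷ []
  comps-1 s = begin
    concatMap g (upTo (suc s))         ≡⟨ cong (concatMap g) (sym (upTo-∷ʳ s)) ⟩
    concatMap g (upTo s ++ s ∷ [])     ≡⟨ concatMap-++ g (upTo s) (s ∷ []) ⟩
    concatMap g (upTo s) ++ g s ++ []
      ≡⟨ cong₂ (λ xs ys → xs ++ ys ++ []) (concatMap-≡[] g (All.map comps-0-∸ (all-upTo s)))
                                          (cong (map (s ∷_) ∘ comps 0) (n∸n≡0 s)) ⟩
    (s ∷ []) ∷ [] ∎
    where
    open ≡-Reasoning
    g : ℕ → List (List ℕ)
    g k = map (k ∷_) (comps 0 (s ∸ k))
    comps-0-∸ : ∀ {k} → k < s → g k ≡ []
    comps-0-∸ {k} k<s with s ∸ k | m>n⇒m∸n≢0 k<s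
    ... | zero  | s∸k≢0 = contradiction refl s∸k≢0
    ... | suc _ | _     = refl

  comps-2 : ∀ r → comps 2 r ≡ map (λ j → j ∷ r ∸ j ∷ []) (upTo (suc r))
  comps-2 r = begin
    concatMap (λ j → map (j ∷_) (comps 1 (r ∸ j))) (upTo (suc r))
      ≡⟨ concatMap-cong (λ j → cong (map (j ∷_)) (comps-1 (r ∸ j))) (upTo (suc r)) ⟩
    concatMap ([_] ∘ f) (upTo (suc r))
      ≡⟨ sym (concatMap-map [_] f (upTo (suc r))) ⟩
    concatMap [_] (map f (upTo (suc r)))
      ≡⟨ concatMap-pure (map f (upTo (suc r))) ⟩
    map f (upTo (suc r)) ∎
    where
    open ≡-Reasoning
    f : ℕ → List ℕ
    f j = j ∷ r ∸ j ∷ []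

  comps-3 : ∀ n → comps 3 n ≡ map toList (monomials n)
  comps-3 n = begin
    concatMap (λ a → map (a ∷_) (comps 2 (n ∸ a))) (upTo (suc n))
      ≡⟨ concatMap-cong (λ a → trans (cong (map (a ∷_)) (comps-2 (n ∸ a)))
                                     (trans (sym (map-∘ (upTo (suc (n ∸ a))))) (map-∘ (upTo (suc (n ∸ a))))))
                        (upTo (suc n)) ⟩
    concatMap (λ a → map toList (row a (n ∸ a))) (upTo (suc n))
      ≡⟨ sym (map-concatMap toList (λ a → row a (n ∸ a)) (upTo (suc n))) ⟩
    map toList (monomials n) ∎
    where open ≡-Reasoning

  plethMonCoeff-ways : ∀ d n α → plethMonCoeff 3 d n (toList α) ≡ ways (monomials n) d 𝟘 α
  plethMonCoeff-ways d n α = begin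
    count (λ m → eqL (vsum 3 m) (toList α)) (msets (comps 3 n) d)
      ≡⟨ cong (λ L → count (λ m → eqL (vsum 3 m) (toList α)) (msets L d)) (comps-3 n) ⟩
    count (λ m → eqL (vsum 3 m) (toList α)) (msets (map toList (monomials n)) d)
      ≡⟨ cong (count _) (msets-map toList (monomials n) d) ⟩
    count (λ m → eqL (vsum 3 m) (toList α)) (map (map toList) (msets (monomials n) d))
      ≡⟨ count-map _ (map toList) (msets (monomials n) d) ⟩
    count (λ m → eqL (vsum 3 (map toList m)) (toList α)) (msets (monomials n) d)
      ≡⟨ count-cong (λ m → trans (cong (λ l → eqL l (toList α)) (vsum-toList m)) (eqL-toList (∑ m) α))
                    (msets (monomials n) d) ⟩
    count (λ m → does (𝟘 ⊕ ∑ m ≟ α)) (msets (monomials n) d)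
      ≡⟨ count-msets (monomials n) d 𝟘 α ⟩
    ways (monomials n) d 𝟘 α ∎
    where open ≡-Reasoning

  rows-suc : ∀ n m → rows n (suc m) ≡ rows n m ++ row m (n ∸ m)
  rows-suc n m = begin
    concatMap F (upTo (suc m))             ≡⟨ cong (concatMap F) (sym (upTo-∷ʳ m)) ⟩
    concatMap F (upTo m ++ m ∷ [])         ≡⟨ concatMap-++ F (upTo m) (m ∷ []) ⟩
    rows n m ++ row m (n ∸ m) ++ []        ≡⟨ cong (rows n m ++_) (++-identityʳ (row m (n ∸ m))) ⟩
    rows n m ++ row m (n ∸ m)              ∎
    where
    open ≡-Reasoning
    F : ℕ → List Mon
    F a = row a (n ∸ a)

  monomials-∷ʳ : ∀ n → monomials n ≡ rows n n ++ x₁^ n ∷ []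
  monomials-∷ʳ n = trans (rows-suc n n) (cong (λ r → rows n n ++ row n r) (n∸n≡0 n))

  rows-lastTwo : ∀ k → rows (2 + k) (2 + k) ≡ rows (2 + k) k ++ row k 2 ++ row (suc k) 1
  rows-lastTwo k = begin
    rows (2 + k) (2 + k)
      ≡⟨ rows-suc (2 + k) (suc k) ⟩
    rows (2 + k) (suc k) ++ row (suc k) (suc k ∸ k)
      ≡⟨ cong₂ _++_ (rows-suc (2 + k) k) (cong (row (suc k)) (m+n∸n≡m 1 k)) ⟩
    (rows (2 + k) k ++ row k (2 + k ∸ k)) ++ row (suc k) 1
      ≡⟨ cong (λ r → (rows (2 + k) k ++ row k r) ++ row (suc k) 1) (m+n∸n≡m 2 k) ⟩
    (rows (2 + k) k ++ row k 2) ++ row (suc k) 1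
      ≡⟨ ++-assoc (rows (2 + k) k) (row k 2) (row (suc k) 1) ⟩
    rows (2 + k) k ++ row k 2 ++ row (suc k) 1 ∎
    where open ≡-Reasoning

  monomials-suc : ∀ n → monomials (suc n) ≡ row 0 (suc n) ++ map x₁·_ (monomials n)
  monomials-suc n = cong (row 0 (suc n) ++_) (begin
    concatMap F (applyUpTo suc (suc n))      ≡⟨ cong (concatMap F) (sym (map-upTo suc (suc n))) ⟩
    concatMap F (map suc (upTo (suc n)))     ≡⟨ concatMap-map F suc (upTo (suc n)) ⟩
    concatMap (F ∘ suc) (upTo (suc n))
      ≡⟨ concatMap-cong (λ a → map-∘ (upTo (suc (n ∸ a)))) (upTo (suc n)) ⟩
    concatMap (map x₁·_ ∘ G) (upTo (suc n))  ≡⟨ sym (map-concatMap x₁·_ G (upTo (suc n))) ⟩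
    map x₁·_ (monomials n)                   ∎)
    where
    open ≡-Reasoning
    F G : ℕ → List Mon
    F a = row a (suc n ∸ a)
    G a = row a (n ∸ a)

  monomials-lastRows : ∀ k →
    monomials (2 + k) ≡ (rows (2 + k) k ++ row k 2) ++ row (suc k) 1 ++ x₁^ (2 + k) ∷ []
  monomials-lastRows k = begin
    monomials (2 + k)                           ≡⟨ monomials-∷ʳ (2 + k) ⟩
    rows (2 + k) (2 + k) ++ x₁^ (2 + k) ∷ []    ≡⟨ cong (_++ x₁^ (2 + k) ∷ []) (rows-lastTwo k) ⟩
    (rows (2 + k) k ++ row k 2 ++ row (suc k) 1) ++ x₁^ (2 + k) ∷ []
      ≡⟨ cong (_++ x₁^ (2 + k) ∷ []) (sym (++-assoc (rows (2 + k) k) (row k 2) (row (suc k) 1))) ⟩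
    ((rows (2 + k) k ++ row k 2) ++ row (suc k) 1) ++ x₁^ (2 + k) ∷ []
      ≡⟨ ++-assoc (rows (2 + k) k ++ row k 2) (row (suc k) 1) (x₁^ (2 + k) ∷ []) ⟩
    (rows (2 + k) k ++ row k 2) ++ row (suc k) 1 ++ x₁^ (2 + k) ∷ [] ∎
    where open ≡-Reasoning

  map-upTo-∷ʳ : ∀ {A : Set} (f : ℕ → A) n → map f (upTo (suc n)) ≡ map f (upTo n) ++ f n ∷ []
  map-upTo-∷ʳ f n = trans (cong (map f) (sym (upTo-∷ʳ n))) (map-++ f (upTo n) (n ∷ []))

  row₀-lastThree : ∀ k → row 0 (3 + k) ≡
    map (λ j → ⟨ 0 , j , 3 + k ∸ j ⟩) (upTo (suc k))
      ++ ⟨ 0 , 1 + k , 2 ⟩ ∷ ⟨ 0 , 2 + k , 1 ⟩ ∷ ⟨ 0 , 3 + k , 0 ⟩ ∷ []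
  row₀-lastThree k = begin
    map f (upTo (4 + k))
      ≡⟨ map-upTo-∷ʳ f (3 + k) ⟩
    map f (upTo (3 + k)) ++ f (3 + k) ∷ []
      ≡⟨ cong (_++ f (3 + k) ∷ []) (map-upTo-∷ʳ f (2 + k)) ⟩
    (map f (upTo (2 + k)) ++ f (2 + k) ∷ []) ++ f (3 + k) ∷ []
      ≡⟨ cong (λ xs → (xs ++ f (2 + k) ∷ []) ++ f (3 + k) ∷ []) (map-upTo-∷ʳ f (1 + k)) ⟩
    ((map f (upTo (1 + k)) ++ f (1 + k) ∷ []) ++ f (2 + k) ∷ []) ++ f (3 + k) ∷ []
      ≡⟨ trans (++-assoc (map f (upTo (1 + k)) ++ f (1 + k) ∷ []) (f (2 + k) ∷ []) (f (3 + k) ∷ []))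
               (++-assoc (map f (upTo (1 + k))) (f (1 + k) ∷ []) (f (2 + k) ∷ f (3 + k) ∷ [])) ⟩
    map f (upTo (1 + k)) ++ f (1 + k) ∷ f (2 + k) ∷ f (3 + k) ∷ []
      ≡⟨ cong₂ (λ a b → map f (upTo (1 + k)) ++ ⟨ 0 , 1 + k , a ⟩ ∷ ⟨ 0 , 2 + k , b ⟩ ∷ f (3 + k) ∷ [])
               (m+n∸n≡m 2 k) (m+n∸n≡m 1 k) ⟩
    map f (upTo (1 + k)) ++ ⟨ 0 , 1 + k , 2 ⟩ ∷ ⟨ 0 , 2 + k , 1 ⟩ ∷ ⟨ 0 , 3 + k , k ∸ k ⟩ ∷ []
      ≡⟨ cong (λ c → map f (upTo (1 + k)) ++ ⟨ 0 , 1 + k , 2 ⟩ ∷ ⟨ 0 , 2 + k , 1 ⟩ ∷ ⟨ 0 , 3 + k , c ⟩ ∷ [])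
              (n∸n≡0 k) ⟩
    map f (upTo (1 + k)) ++ ⟨ 0 , 1 + k , 2 ⟩ ∷ ⟨ 0 , 2 + k , 1 ⟩ ∷ ⟨ 0 , 3 + k , 0 ⟩ ∷ [] ∎
    where
    open ≡-Reasoning
    f : ℕ → Mon
    f j = ⟨ 0 , j , 3 + k ∸ j ⟩

  row-e₂₃ : ∀ a r → All (λ x → e₂₃ x ≡ r) (row a r)
  row-e₂₃ a r = map⁺ (All.map (λ j<1+r → m∸n+n≡m (s≤s⁻¹ j<1+r)) (all-upTo (suc r)))

  rows-e₂₃ : ∀ n m → m ≤ n → All (λ x → n ∸ m < e₂₃ x) (rows n m)
  rows-e₂₃ n m m≤n = concat⁺ (map⁺ (All.map
    (λ {a} a<m → All.map (λ e → subst (n ∸ m <_) (sym e) (∸-monoʳ-< a<m m≤n)) (row-e₂₃ a (n ∸ a)))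
    (all-upTo m)))

  rows-positive : ∀ n → All (λ x → 0 < e₂₃ x) (rows n n)
  rows-positive n = All.map (λ {x} → subst (_< e₂₃ x) (n∸n≡0 n)) (rows-e₂₃ n n ≤-refl)

  rows-lowerHeavy : ∀ k → All (λ x → 2 < e₂₃ x) (rows (2 + k) k)
  rows-lowerHeavy k = All.map (λ {x} → subst (_< e₂₃ x) (m+n∸n≡m 2 k)) (rows-e₂₃ (2 + k) k (m≤n+m k 2))

  rows-row₂-heavy : ∀ k → All (λ x → 1 < e₂₃ x) (rows (2 + k) k ++ row k 2)
  rows-row₂-heavy k = ++⁺ (All.map (≤-trans (n≤1+n 2)) (rows-lowerHeavy k)) (≤-refl ∷ ≤-refl ∷ ≤-refl ∷ [])

  plethMonCoeff-[n+1][n]-split : ∀ n α → plethMonCoeff 3 (suc n) n (toList α) ≡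
                            ways (monomials n) n (x₁^ n) α + ways (rows n n) (suc n) 𝟘 α
  plethMonCoeff-[n+1][n]-split n α = begin
    plethMonCoeff 3 (suc n) n (toList α)        ≡⟨ plethMonCoeff-ways (suc n) n α ⟩
    ways (monomials n) (suc n) 𝟘 α              ≡⟨ cong (λ L → ways L (suc n) 𝟘 α) (monomials-∷ʳ n) ⟩
    ways (rows n n ++ x₁^ n ∷ []) (suc n) 𝟘 α    ≡⟨ ways-∷ʳ (x₁^ n) (rows n n) n 𝟘 α ⟩
    ways (rows n n ++ x₁^ n ∷ []) n (x₁^ n) α + ways (rows n n) (suc n) 𝟘 α
      ≡⟨ cong (λ L → ways L n (x₁^ n) α + ways (rows n n) (suc n) 𝟘 α) (sym (monomials-∷ʳ n)) ⟩
    ways (monomials n) n (x₁^ n) α + ways (rows n n) (suc n) 𝟘 α ∎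
    where open ≡-Reasoning

  plethMonCoeff-[n][n+1]-split : ∀ n α → plethMonCoeff 3 n (suc n) (toList α) ≡
                           ways (row 0 (suc n) ++ map x₁·_ (monomials n)) n 𝟘 α
  plethMonCoeff-[n][n+1]-split n α =
    trans (plethMonCoeff-ways n (suc n) α) (cong (λ L → ways L n 𝟘 α) (monomials-suc n))

  ways-x₁·monomials : ∀ n α → ways (map x₁·_ (monomials n)) n 𝟘 α ≡ ways (monomials n) n (x₁^ n) α
  ways-x₁·monomials n α =
    trans (ways-map-x₁· (monomials n) n 𝟘 α) (cong (λ γ → ways (monomials n) n γ α) (⊕-identityʳ (x₁^ n)))

  plethMonCoeff-compare : ∀ n α a b → ways (rows n n) (suc n) 𝟘 α ≡ a + b →
    ways (row 0 (suc n) ++ map x₁·_ (monomials n)) n 𝟘 α ≡ b + ways (map x₁·_ (monomials n)) n 𝟘 α →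
    plethMonCoeff 3 (suc n) n (toList α) ≡ a + plethMonCoeff 3 n (suc n) (toList α)
  plethMonCoeff-compare n α a b lhs rhs = begin
    plethMonCoeff 3 (suc n) n (toList α)  ≡⟨ plethMonCoeff-[n+1][n]-split n α ⟩
    z + ways (rows n n) (suc n) 𝟘 α       ≡⟨ cong (z +_) lhs ⟩
    z + (a + b)                           ≡⟨ x∙yz≈y∙zx z a b ⟩
    a + (b + z)                           ≡⟨ cong (λ c → a + (b + c)) (sym (ways-x₁·monomials n α)) ⟩
    a + (b + ways (map x₁·_ (monomials n)) n 𝟘 α)
      ≡⟨ cong (a +_) (sym rhs) ⟩
    a + ways (row 0 (suc n) ++ map x₁·_ (monomials n)) n 𝟘 α
      ≡⟨ cong (a +_) (sym (plethMonCoeff-[n][n+1]-split n α)) ⟩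
    a + plethMonCoeff 3 n (suc n) (toList α) ∎
    where
    open ≡-Reasoning
    z : ℕ
    z = ways (monomials n) n (x₁^ n) α

  -- The six targets for λ = (N² − 2, N, 2), N = 2 + k

  rows-dropToRow₂ : ∀ k α → e₂₃ α ≤ 4 + k →
    ways (rows (2 + k) (2 + k)) (3 + k) 𝟘 α ≡ ways (row k 2 ++ row (suc k) 1) (3 + k) 𝟘 α
  rows-dropToRow₂ k α α≤ = trans (cong (λ L → ways L (3 + k) 𝟘 α) (rows-lastTwo k))
    (E₂₃.ways-++-dropHeavy (rows (2 + k) k) (row k 2 ++ row (suc k) 1) (rows-lowerHeavy k)
      (subst (All (λ x → 1 ≤ e₂₃ x)) (rows-lastTwo k) (rows-positive (2 + k))) (2 + k) 𝟘 α
      (subst (e₂₃ α ≤_) (bound k) α≤))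
    where
    bound : ∀ k → 4 + k ≡ 0 + (2 + k) * 1 + 2
    bound = solve-∀

  rows-dropToRow₁ : ∀ k α → e₂₃ α ≤ 3 + k →
    ways (rows (2 + k) (2 + k)) (3 + k) 𝟘 α ≡ ways (row (suc k) 1) (3 + k) 𝟘 α
  rows-dropToRow₁ k α α≤ = trans (cong (λ L → ways L (3 + k) 𝟘 α) split)
    (E₂₃.ways-++-dropHeavy (rows (2 + k) k ++ row k 2) (row (suc k) 1) (rows-row₂-heavy k)
      (subst (All (λ x → 1 ≤ e₂₃ x)) split (rows-positive (2 + k))) (2 + k) 𝟘 α
      (subst (e₂₃ α ≤_) (bound k) α≤))
    where
    split : rows (2 + k) (2 + k) ≡ (rows (2 + k) k ++ row k 2) ++ row (suc k) 1
    split = trans (rows-lastTwo k) (sym (++-assoc (rows (2 + k) k) (row k 2) (row (suc k) 1)))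
    bound : ∀ k → 3 + k ≡ 0 + (2 + k) * 1 + 1
    bound = solve-∀

  rows-tooHeavy : ∀ k α → e₂₃ α < 3 + k → ways (rows (2 + k) (2 + k)) (3 + k) 𝟘 α ≡ 0
  rows-tooHeavy k α α< = E₂₃.ways-tooHeavy (rows (2 + k) (2 + k)) (rows-positive (2 + k)) (3 + k) 𝟘 α
    (subst (e₂₃ α <_) (bound k) α<)
    where
    bound : ∀ k → 3 + k ≡ 0 + (3 + k) * 1
    bound = solve-∀

  row₂-dropToRow₁ : ∀ k qs β α → All (λ x → 1 < e₂₃ x) qs → e₂₃ α ≤ e₂₃ β + (2 + k) →
    ways (qs ++ row (suc k) 1) (2 + k) β α ≡ ways (row (suc k) 1) (2 + k) β α
  row₂-dropToRow₁ k qs β α heavy α≤ = E₂₃.ways-++-dropHeavy qs (row (suc k) 1) heavy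
    (++⁺ (All.map <⇒≤ heavy) (≤-refl ∷ ≤-refl ∷ [])) (suc k) β α
    (subst (e₂₃ α ≤_) (bound (e₂₃ β) k) α≤)
    where
    bound : ∀ w k → w + (2 + k) ≡ w + (1 + k) * 1 + 1
    bound = solve-∀

  row₁-tooLight : ∀ k α → 4 + k ≤ e₂₃ α → ways (row (suc k) 1) (3 + k) 𝟘 α ≡ 0
  row₁-tooLight k α α≥ = E₂₃.ways-tooLight (row (suc k) 1) (≤-refl ∷ ≤-refl ∷ []) (3 + k) 𝟘 α
    (subst (_< e₂₃ α) (bound k) α≥)
    where
    bound : ∀ k → 3 + k ≡ 0 + (3 + k) * 1
    bound = solve-∀

  row₀-dropHeavy : ∀ k L α → e₃ α ≤ 2 →
    ways (row 0 (3 + k) ++ L) (2 + k) 𝟘 α ≡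
    ways (⟨ 0 , 1 + k , 2 ⟩ ∷ ⟨ 0 , 2 + k , 1 ⟩ ∷ ⟨ 0 , 3 + k , 0 ⟩ ∷ L) (2 + k) 𝟘 α
  row₀-dropHeavy k L α α≤ = begin
    ways (row 0 (3 + k) ++ L) (2 + k) 𝟘 α
      ≡⟨ cong (λ R → ways (R ++ L) (2 + k) 𝟘 α) (row₀-lastThree k) ⟩
    ways ((P ++ lastThree) ++ L) (2 + k) 𝟘 α
      ≡⟨ cong (λ R → ways R (2 + k) 𝟘 α) (++-assoc P lastThree L) ⟩
    ways (P ++ lastThree ++ L) (2 + k) 𝟘 α
      ≡⟨ E₃.ways-++-dropHeavy₀ P (lastThree ++ L) P-heavy (suc k) 𝟘 α α≤ ⟩
    ways (lastThree ++ L) (2 + k) 𝟘 α ∎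
    where
    open ≡-Reasoning
    P lastThree : List Mon
    P = map (λ j → ⟨ 0 , j , 3 + k ∸ j ⟩) (upTo (suc k))
    lastThree = ⟨ 0 , 1 + k , 2 ⟩ ∷ ⟨ 0 , 2 + k , 1 ⟩ ∷ ⟨ 0 , 3 + k , 0 ⟩ ∷ []
    P-heavy : All (λ x → 2 < e₃ x) P
    P-heavy = map⁺ (All.map
      (λ {j} j<1+k → subst (_< 3 + k ∸ j) (m+n∸n≡m 2 k) (∸-monoʳ-< j<1+k (m≤n+m (suc k) 2)))
      (all-upTo (suc k)))

  x₁·monomials-dropToRow₁ : ∀ k ps β α → All (λ x → 1 < e₂₃ x) ps → e₂₃ α ≤ 1 + e₂₃ β →
    ways (ps ++ map x₁·_ (monomials (2 + k))) (suc k) β α ≡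
    ways (row (suc k) 1 ++ x₁^ (2 + k) ∷ []) (suc k) (x₁^ suc k ⊕ β) α
  x₁·monomials-dropToRow₁ k ps β α heavy α≤ = begin
    ways (ps ++ map x₁·_ (monomials (2 + k))) (suc k) β α
      ≡⟨ E₂₃.ways-++-dropHeavy₀ ps (map x₁·_ (monomials (2 + k))) heavy k β α α≤ ⟩
    ways (map x₁·_ (monomials (2 + k))) (suc k) β α
      ≡⟨ ways-map-x₁· (monomials (2 + k)) (suc k) β α ⟩
    ways (monomials (2 + k)) (suc k) (x₁^ suc k ⊕ β) α
      ≡⟨ cong (λ L → ways L (suc k) (x₁^ suc k ⊕ β) α) (monomials-lastRows k) ⟩
    ways ((rows (2 + k) k ++ row k 2) ++ row (suc k) 1 ++ x₁^ (2 + k) ∷ []) (suc k) (x₁^ suc k ⊕ β) α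
      ≡⟨ E₂₃.ways-++-dropHeavy₀ (rows (2 + k) k ++ row k 2) (row (suc k) 1 ++ x₁^ (2 + k) ∷ [])
                                (rows-row₂-heavy k) k (x₁^ suc k ⊕ β) α α≤ ⟩
    ways (row (suc k) 1 ++ x₁^ (2 + k) ∷ []) (suc k) (x₁^ suc k ⊕ β) α ∎
    where open ≡-Reasoning

  -- The x₁-exponent of a target as it arises from the monomials of its multisets; a = N² − 4.
  a+2-viaRow₂ : ∀ k → 2 + k * (4 + k) ≡ k + (2 + k) * (1 + k)
  a+2-viaRow₂ = solve-∀

  a+3-viaRow₁ : ∀ k → 3 + k * (4 + k) ≡ (3 + k) * (1 + k)
  a+3-viaRow₁ = solve-∀

  a+2-viaRow₀ : ∀ k → 2 + k * (4 + k) ≡ 1 * (1 + k) + k * (2 + k) + (1 + k + 0)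
  a+2-viaRow₀ = solve-∀

  a+3-viaRow₀ : ∀ k → 3 + k * (4 + k) ≡ 0 * (1 + k) + (1 + k) * (2 + k) + (1 + k + 0)
  a+3-viaRow₀ = solve-∀

  -- α₁ … α₆ are the exponents λ + δ − σδ, σ ∈ S₃, for λ = (2 + a, N, 2).  The left excess is
  -- ways (rows N N) (1 + N) 𝟘, the right one what ways (row 0 (1 + N) ++ Q) N 𝟘 adds to ways Q N 𝟘.
  module Excess (k : ℕ) where

    a : ℕ
    a = k * (4 + k)

    α₁ α₂ α₃ α₄ α₅ α₆ : Mon
    α₁ = ⟨ 2 + a , 2 + k , 2 ⟩
    α₂ = ⟨ 3 + a , 1 + k , 2 ⟩
    α₃ = ⟨ 3 + a , 3 + k , 0 ⟩
    α₄ = ⟨ 2 + a , 3 + k , 1 ⟩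
    α₅ = ⟨ 4 + a , 1 + k , 1 ⟩
    α₆ = ⟨ 4 + a , 2 + k , 0 ⟩

    q₀ q₁ q₂ p₁ p₂ p₃ : Mon
    q₀ = ⟨ k , 0 , 2 ⟩
    q₁ = ⟨ k , 1 , 1 ⟩
    q₂ = ⟨ k , 2 , 0 ⟩
    p₁ = ⟨ 0 , 1 + k , 2 ⟩
    p₂ = ⟨ 0 , 2 + k , 1 ⟩
    p₃ = ⟨ 0 , 3 + k , 0 ⟩

    Q : List Mon
    Q = map x₁·_ (monomials (2 + k))

    2≤ : ∀ {n} → 2 ≤ 3 + n
    2≤ = s≤s (s≤s z≤n)

    excessˡ-split : ∀ α {t₀ t₁ t₂} → e₂₃ α ≡ 4 + k →
      ways (q₀ ∷ q₁ ∷ q₂ ∷ row (suc k) 1) (2 + k) q₀ α ≡ t₀ →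
      ways (q₁ ∷ q₂ ∷ row (suc k) 1) (2 + k) q₁ α ≡ t₁ →
      ways (q₂ ∷ row (suc k) 1) (2 + k) q₂ α ≡ t₂ →
      ways (rows (2 + k) (2 + k)) (3 + k) 𝟘 α ≡ t₀ + (t₁ + t₂)
    excessˡ-split α α≡ via-q₀ via-q₁ via-q₂ = trans (rows-dropToRow₂ k α (≤-reflexive α≡))
      (cong₂ _+_ via-q₀ (cong₂ _+_ via-q₁ (trans (cong₂ _+_ via-q₂ (row₁-tooLight k α (≤-reflexive (sym α≡))))
                                                 (+-identityʳ _))))

    excessʳ-split : ∀ α {t₁ t₂ t₃} → e₃ α ≤ 2 →
      ways (p₁ ∷ p₂ ∷ p₃ ∷ Q) (suc k) p₁ α ≡ t₁ →
      ways (p₂ ∷ p₃ ∷ Q) (suc k) p₂ α ≡ t₂ →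
      ways (p₃ ∷ Q) (suc k) p₃ α ≡ t₃ →
      ways (row 0 (3 + k) ++ Q) (2 + k) 𝟘 α ≡ t₁ + (t₂ + (t₃ + ways Q (2 + k) 𝟘 α))
    excessʳ-split α α≤ via-p₁ via-p₂ via-p₃ = trans (row₀-dropHeavy k Q α α≤)
      (cong₂ _+_ via-p₁ (cong₂ _+_ via-p₂ (cong (_+ ways Q (2 + k) 𝟘 α) via-p₃)))

    excessˡ-α₁ : ways (rows (2 + k) (2 + k)) (3 + k) 𝟘 α₁ ≡ 3
    excessˡ-α₁ = excessˡ-split α₁ refl via-q₀ via-q₁ via-q₂
      where
      via-q₀ : ways (q₀ ∷ q₁ ∷ q₂ ∷ row (suc k) 1) (2 + k) q₀ α₁ ≡ 1
      via-q₀ = trans (row₂-dropToRow₁ k (q₀ ∷ q₁ ∷ q₂ ∷ []) q₀ α₁ (≤-refl ∷ ≤-refl ∷ ≤-refl ∷ []) ≤-refl)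
                     (ways-row₁ (suc k) 0 (2 + k) q₀ α₁ (Mon-≡ (a+2-viaRow₂ k) refl refl))
      via-q₁ : ways (q₁ ∷ q₂ ∷ row (suc k) 1) (2 + k) q₁ α₁ ≡ 1
      via-q₁ = trans (row₂-dropToRow₁ k (q₁ ∷ q₂ ∷ []) q₁ α₁ (≤-refl ∷ ≤-refl ∷ []) ≤-refl)
                     (ways-row₁ (suc k) 1 (1 + k) q₁ α₁ (Mon-≡ (a+2-viaRow₂ k) refl refl))
      via-q₂ : ways (q₂ ∷ row (suc k) 1) (2 + k) q₂ α₁ ≡ 1
      via-q₂ = trans (row₂-dropToRow₁ k (q₂ ∷ []) q₂ α₁ (≤-refl ∷ []) ≤-refl)
                     (ways-row₁ (suc k) 2 k q₂ α₁ (Mon-≡ (a+2-viaRow₂ k) refl refl))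

    excessˡ-α₂ : ways (rows (2 + k) (2 + k)) (3 + k) 𝟘 α₂ ≡ 1
    excessˡ-α₂ = trans (rows-dropToRow₁ k α₂ ≤-refl)
                       (ways-row₁ (suc k) 2 (1 + k) 𝟘 α₂ (Mon-≡ (a+3-viaRow₁ k) refl refl))

    excessˡ-α₃ : ways (rows (2 + k) (2 + k)) (3 + k) 𝟘 α₃ ≡ 1
    excessˡ-α₃ = trans (rows-dropToRow₁ k α₃ ≤-refl)
                       (ways-row₁ (suc k) 0 (3 + k) 𝟘 α₃ (Mon-≡ (a+3-viaRow₁ k) refl refl))

    excessˡ-α₄ : ways (rows (2 + k) (2 + k)) (3 + k) 𝟘 α₄ ≡ 2
    excessˡ-α₄ = excessˡ-split α₄ refl via-q₀ via-q₁ via-q₂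
      where
      via-q₀ : ways (q₀ ∷ q₁ ∷ q₂ ∷ row (suc k) 1) (2 + k) q₀ α₄ ≡ 0
      via-q₀ = E₃.ways-belowStart (q₀ ∷ q₁ ∷ q₂ ∷ row (suc k) 1) (2 + k) q₀ α₄ ≤-refl
      via-q₁ : ways (q₁ ∷ q₂ ∷ row (suc k) 1) (2 + k) q₁ α₄ ≡ 1
      via-q₁ = trans (row₂-dropToRow₁ k (q₁ ∷ q₂ ∷ []) q₁ α₄ (≤-refl ∷ ≤-refl ∷ []) ≤-refl)
                     (ways-row₁ (suc k) 0 (2 + k) q₁ α₄ (Mon-≡ (a+2-viaRow₂ k) refl refl))
      via-q₂ : ways (q₂ ∷ row (suc k) 1) (2 + k) q₂ α₄ ≡ 1
      via-q₂ = trans (row₂-dropToRow₁ k (q₂ ∷ []) q₂ α₄ (≤-refl ∷ []) ≤-refl)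
                     (ways-row₁ (suc k) 1 (1 + k) q₂ α₄ (Mon-≡ (a+2-viaRow₂ k) refl refl))

    excessˡ-α₅ : ways (rows (2 + k) (2 + k)) (3 + k) 𝟘 α₅ ≡ 0
    excessˡ-α₅ = rows-tooHeavy k α₅ ≤-refl

    excessˡ-α₆ : ways (rows (2 + k) (2 + k)) (3 + k) 𝟘 α₆ ≡ 0
    excessˡ-α₆ = rows-tooHeavy k α₆ ≤-refl

    excessʳ-α₁ : ways (row 0 (3 + k) ++ Q) (2 + k) 𝟘 α₁ ≡ 2 + ways Q (2 + k) 𝟘 α₁
    excessʳ-α₁ = excessʳ-split α₁ ≤-refl via-p₁ via-p₂ via-p₃
      where
      via-p₁ : ways (p₁ ∷ p₂ ∷ p₃ ∷ Q) (suc k) p₁ α₁ ≡ 1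
      via-p₁ = trans (x₁·monomials-dropToRow₁ k (p₁ ∷ p₂ ∷ p₃ ∷ []) p₁ α₁ (2≤ ∷ 2≤ ∷ 2≤ ∷ []) ≤-refl)
                     (ways-row₁-∷ʳ (suc k) 0 1 k (x₁^ suc k ⊕ p₁) α₁ (Mon-≡ (a+2-viaRow₀ k) refl refl))
      via-p₂ : ways (p₂ ∷ p₃ ∷ Q) (suc k) p₂ α₁ ≡ 1
      via-p₂ = trans (x₁·monomials-dropToRow₁ k (p₂ ∷ p₃ ∷ []) p₂ α₁ (2≤ ∷ 2≤ ∷ []) ≤-refl)
                     (ways-row₁-∷ʳ (suc k) 1 0 k (x₁^ suc k ⊕ p₂) α₁ (Mon-≡ (a+2-viaRow₀ k) refl refl))
      via-p₃ : ways (p₃ ∷ Q) (suc k) p₃ α₁ ≡ 0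
      via-p₃ = E₂.ways-belowStart (p₃ ∷ Q) (suc k) p₃ α₁ ≤-refl

    excessʳ-α₂ : ways (row 0 (3 + k) ++ Q) (2 + k) 𝟘 α₂ ≡ 1 + ways Q (2 + k) 𝟘 α₂
    excessʳ-α₂ = excessʳ-split α₂ ≤-refl via-p₁ via-p₂ via-p₃
      where
      via-p₁ : ways (p₁ ∷ p₂ ∷ p₃ ∷ Q) (suc k) p₁ α₂ ≡ 1
      via-p₁ = trans (x₁·monomials-dropToRow₁ k (p₁ ∷ p₂ ∷ p₃ ∷ []) p₁ α₂ (2≤ ∷ 2≤ ∷ 2≤ ∷ []) (n≤1+n _))
                     (ways-row₁-∷ʳ (suc k) 0 0 (suc k) (x₁^ suc k ⊕ p₁) α₂
                                   (Mon-≡ (a+3-viaRow₀ k) refl refl))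
      via-p₂ : ways (p₂ ∷ p₃ ∷ Q) (suc k) p₂ α₂ ≡ 0
      via-p₂ = E₂.ways-belowStart (p₂ ∷ p₃ ∷ Q) (suc k) p₂ α₂ ≤-refl
      via-p₃ : ways (p₃ ∷ Q) (suc k) p₃ α₂ ≡ 0
      via-p₃ = E₂.ways-belowStart (p₃ ∷ Q) (suc k) p₃ α₂ (n≤1+n _)

    excessʳ-α₃ : ways (row 0 (3 + k) ++ Q) (2 + k) 𝟘 α₃ ≡ 1 + ways Q (2 + k) 𝟘 α₃
    excessʳ-α₃ = excessʳ-split α₃ z≤n via-p₁ via-p₂ via-p₃
      where
      via-p₁ : ways (p₁ ∷ p₂ ∷ p₃ ∷ Q) (suc k) p₁ α₃ ≡ 0
      via-p₁ = E₃.ways-belowStart (p₁ ∷ p₂ ∷ p₃ ∷ Q) (suc k) p₁ α₃ z<s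
      via-p₂ : ways (p₂ ∷ p₃ ∷ Q) (suc k) p₂ α₃ ≡ 0
      via-p₂ = E₃.ways-belowStart (p₂ ∷ p₃ ∷ Q) (suc k) p₂ α₃ z<s
      via-p₃ : ways (p₃ ∷ Q) (suc k) p₃ α₃ ≡ 1
      via-p₃ = trans (x₁·monomials-dropToRow₁ k (p₃ ∷ []) p₃ α₃ (2≤ ∷ []) (n≤1+n _))
                     (ways-row₁-∷ʳ (suc k) 0 0 (suc k) (x₁^ suc k ⊕ p₃) α₃
                                   (Mon-≡ (a+3-viaRow₀ k) refl refl))

    excessʳ-α₄ : ways (row 0 (3 + k) ++ Q) (2 + k) 𝟘 α₄ ≡ 2 + ways Q (2 + k) 𝟘 α₄
    excessʳ-α₄ = excessʳ-split α₄ (s≤s z≤n) via-p₁ via-p₂ via-p₃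
      where
      via-p₁ : ways (p₁ ∷ p₂ ∷ p₃ ∷ Q) (suc k) p₁ α₄ ≡ 0
      via-p₁ = E₃.ways-belowStart (p₁ ∷ p₂ ∷ p₃ ∷ Q) (suc k) p₁ α₄ ≤-refl
      via-p₂ : ways (p₂ ∷ p₃ ∷ Q) (suc k) p₂ α₄ ≡ 1
      via-p₂ = trans (x₁·monomials-dropToRow₁ k (p₂ ∷ p₃ ∷ []) p₂ α₄ (2≤ ∷ 2≤ ∷ []) ≤-refl)
                     (ways-row₁-∷ʳ (suc k) 0 1 k (x₁^ suc k ⊕ p₂) α₄ (Mon-≡ (a+2-viaRow₀ k) refl refl))
      via-p₃ : ways (p₃ ∷ Q) (suc k) p₃ α₄ ≡ 1
      via-p₃ = trans (x₁·monomials-dropToRow₁ k (p₃ ∷ []) p₃ α₄ (2≤ ∷ []) ≤-refl)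
                     (ways-row₁-∷ʳ (suc k) 1 0 k (x₁^ suc k ⊕ p₃) α₄ (Mon-≡ (a+2-viaRow₀ k) refl refl))

    excessʳ-α₅ : ways (row 0 (3 + k) ++ Q) (2 + k) 𝟘 α₅ ≡ 0 + ways Q (2 + k) 𝟘 α₅
    excessʳ-α₅ = excessʳ-split α₅ (s≤s z≤n) via-p₁ via-p₂ via-p₃
      where
      via-p₁ : ways (p₁ ∷ p₂ ∷ p₃ ∷ Q) (suc k) p₁ α₅ ≡ 0
      via-p₁ = E₃.ways-belowStart (p₁ ∷ p₂ ∷ p₃ ∷ Q) (suc k) p₁ α₅ ≤-refl
      via-p₂ : ways (p₂ ∷ p₃ ∷ Q) (suc k) p₂ α₅ ≡ 0
      via-p₂ = E₂.ways-belowStart (p₂ ∷ p₃ ∷ Q) (suc k) p₂ α₅ ≤-refl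
      via-p₃ : ways (p₃ ∷ Q) (suc k) p₃ α₅ ≡ 0
      via-p₃ = E₂.ways-belowStart (p₃ ∷ Q) (suc k) p₃ α₅ (n≤1+n _)

    excessʳ-α₆ : ways (row 0 (3 + k) ++ Q) (2 + k) 𝟘 α₆ ≡ 0 + ways Q (2 + k) 𝟘 α₆
    excessʳ-α₆ = excessʳ-split α₆ z≤n via-p₁ via-p₂ via-p₃
      where
      via-p₁ : ways (p₁ ∷ p₂ ∷ p₃ ∷ Q) (suc k) p₁ α₆ ≡ 0
      via-p₁ = E₃.ways-belowStart (p₁ ∷ p₂ ∷ p₃ ∷ Q) (suc k) p₁ α₆ z<s
      via-p₂ : ways (p₂ ∷ p₃ ∷ Q) (suc k) p₂ α₆ ≡ 0
      via-p₂ = E₃.ways-belowStart (p₂ ∷ p₃ ∷ Q) (suc k) p₂ α₆ z<s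
      via-p₃ : ways (p₃ ∷ Q) (suc k) p₃ α₆ ≡ 0
      via-p₃ = E₂.ways-belowStart (p₃ ∷ Q) (suc k) p₃ α₆ ≤-refl

  square∸2 : ∀ k → (2 + k) * (2 + k) ∸ 2 ≡ 2 + k * (4 + k)
  square∸2 k = expand k
    where
    expand : ∀ k → k + (1 + k) * (2 + k) ≡ 2 + k * (4 + k)
    expand = solve-∀

  alternatingSum : ℕ → ℕ → ℕ → ℕ → ℕ → ℕ → ℤ
  alternatingSum x₁ x₂ x₃ x₄ x₅ x₆ = (x₁ + x₃ + x₅) ⊖ (x₂ + x₄ + x₆)

  alternatingSum-suc : ∀ {x₁ x₂ x₃ x₄ x₅ x₆ y₁ y₂ y₃ y₄ y₅ y₆} →
    x₁ ≡ 1 + y₁ → x₂ ≡ y₂ → x₃ ≡ y₃ → x₄ ≡ y₄ → x₅ ≡ y₅ → x₆ ≡ y₆ →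
    alternatingSum x₁ x₂ x₃ x₄ x₅ x₆ ≡ ℤ.suc (alternatingSum y₁ y₂ y₃ y₄ y₅ y₆)
  alternatingSum-suc {y₁ = y₁} {y₂} {y₃} {y₄} {y₅} {y₆} refl refl refl refl refl refl =
    sym (distribʳ-⊖-+-pos 1 (y₁ + y₃ + y₅) (y₂ + y₄ + y₆))

  schurCoeff-[2+a,2+b,2] : ∀ c a b → schurCoeff c (2 + a ∷ 2 + b ∷ 2 ∷ []) ≡
    alternatingSum (c (2 + a ∷ 2 + b ∷ 2 ∷ [])) (c (3 + a ∷ 1 + b ∷ 2 ∷ [])) (c (3 + a ∷ 3 + b ∷ 0 ∷ []))
                   (c (2 + a ∷ 3 + b ∷ 1 ∷ [])) (c (4 + a ∷ 1 + b ∷ 1 ∷ [])) (c (4 + a ∷ 2 + b ∷ 0 ∷ []))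
  -- schurCoeff computes on this shape, with the exponents written as a + 2 and b + 1.
  schurCoeff-[2+a,2+b,2] c a b = begin
    schurCoeff c (2 + a ∷ 2 + b ∷ 2 ∷ [])
      ≡⟨ signs (c₁ a₂ b₁) (c₂ a₂ b₁) (c₃ a₂ b₁) (c₄ a₂ b₁) (c₅ a₂ b₁) (c₆ a₂ b₁) ⟩
    alternatingSum (c₁ a₂ b₁) (c₂ a₂ b₁) (c₃ a₂ b₁) (c₄ a₂ b₁) (c₅ a₂ b₁) (c₆ a₂ b₁)
      ≡⟨ cong₂ (λ a₂ b₁ → alternatingSum (c₁ a₂ b₁) (c₂ a₂ b₁) (c₃ a₂ b₁) (c₄ a₂ b₁) (c₅ a₂ b₁) (c₆ a₂ b₁))
               (+-comm a 2) (+-comm b 1) ⟩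
    alternatingSum (c₁ (2 + a) (1 + b)) (c₂ (2 + a) (1 + b)) (c₃ (2 + a) (1 + b))
                   (c₄ (2 + a) (1 + b)) (c₅ (2 + a) (1 + b)) (c₆ (2 + a) (1 + b)) ∎
    where
    open ≡-Reasoning
    a₂ b₁ : ℕ
    a₂ = a + 2
    b₁ = b + 1
    c₁ c₂ c₃ c₄ c₅ c₆ : ℕ → ℕ → ℕ
    c₁ a₂ b₁ = c (a₂ ∷ suc b₁ ∷ 2 ∷ [])
    c₂ a₂ b₁ = c (suc a₂ ∷ b₁ ∷ 2 ∷ [])
    c₃ a₂ b₁ = c (suc a₂ ∷ suc (suc b₁) ∷ 0 ∷ [])
    c₄ a₂ b₁ = c (a₂ ∷ suc (suc b₁) ∷ 1 ∷ [])
    c₅ a₂ b₁ = c (suc (suc a₂) ∷ b₁ ∷ 1 ∷ [])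
    c₆ a₂ b₁ = c (suc (suc a₂) ∷ suc b₁ ∷ 0 ∷ [])
    signs : ∀ x₁ x₂ x₃ x₄ x₅ x₆ →
      1ℤ ℤ.* ℤ.+ x₁ ℤ.+ (-1ℤ ℤ.* ℤ.+ x₂ ℤ.+ (1ℤ ℤ.* ℤ.+ x₃ ℤ.+
        (-1ℤ ℤ.* ℤ.+ x₄ ℤ.+ (1ℤ ℤ.* ℤ.+ x₅ ℤ.+ (-1ℤ ℤ.* ℤ.+ x₆ ℤ.+ 0ℤ)))))
        ≡ alternatingSum x₁ x₂ x₃ x₄ x₅ x₆
    signs x₁ x₂ x₃ x₄ x₅ x₆ = begin
      _ ≡⟨ regroup (ℤ.+ x₁) (ℤ.+ x₂) (ℤ.+ x₃) (ℤ.+ x₄) (ℤ.+ x₅) (ℤ.+ x₆) ⟩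
      ℤ.+ x₁ ℤ.+ ℤ.+ x₃ ℤ.+ ℤ.+ x₅ ℤ.- (ℤ.+ x₂ ℤ.+ ℤ.+ x₄ ℤ.+ ℤ.+ x₆)
        ≡⟨ cong₂ ℤ._-_ (sym (trans (pos-+ (x₁ + x₃) x₅) (cong (ℤ._+ ℤ.+ x₅) (pos-+ x₁ x₃))))
                       (sym (trans (pos-+ (x₂ + x₄) x₆) (cong (ℤ._+ ℤ.+ x₆) (pos-+ x₂ x₄)))) ⟩
      ℤ.+ (x₁ + x₃ + x₅) ℤ.- ℤ.+ (x₂ + x₄ + x₆)
        ≡⟨ [+m]-[+n]≡m⊖n (x₁ + x₃ + x₅) (x₂ + x₄ + x₆) ⟩
      alternatingSum x₁ x₂ x₃ x₄ x₅ x₆ ∎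
      where
      regroup : ∀ x₁ x₂ x₃ x₄ x₅ x₆ →
        1ℤ ℤ.* x₁ ℤ.+ (-1ℤ ℤ.* x₂ ℤ.+ (1ℤ ℤ.* x₃ ℤ.+ (-1ℤ ℤ.* x₄ ℤ.+ (1ℤ ℤ.* x₅ ℤ.+ (-1ℤ ℤ.* x₆ ℤ.+ 0ℤ)))))
          ≡ x₁ ℤ.+ x₃ ℤ.+ x₅ ℤ.- (x₂ ℤ.+ x₄ ℤ.+ x₆)
      regroup = ℤ-solve-∀

  plethCoeff-[N²-2,N,2] : ∀ k →
    plethCoeff ((2 + k) * (2 + k) ∸ 2 ∷ 2 + k ∷ 2 ∷ []) (3 + k) (2 + k)
      ≡ ℤ.suc (plethCoeff ((2 + k) * (2 + k) ∸ 2 ∷ 2 + k ∷ 2 ∷ []) (2 + k) (3 + k))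
  plethCoeff-[N²-2,N,2] k = begin
    plethCoeff (shape ((2 + k) * (2 + k) ∸ 2)) (3 + k) (2 + k)
      ≡⟨ cong (λ m → plethCoeff (shape m) (3 + k) (2 + k)) (square∸2 k) ⟩
    plethCoeff (shape (2 + a)) (3 + k) (2 + k)
      ≡⟨ schurCoeff-[2+a,2+b,2] (plethMonCoeff 3 (3 + k) (2 + k)) a k ⟩
    alternatingSum (lhs α₁) (lhs α₂) (lhs α₃) (lhs α₄) (lhs α₅) (lhs α₆)
      ≡⟨ alternatingSum-suc (plethMonCoeff-compare (2 + k) α₁ 1 2 excessˡ-α₁ excessʳ-α₁)
                            (plethMonCoeff-compare (2 + k) α₂ 0 1 excessˡ-α₂ excessʳ-α₂)
                            (plethMonCoeff-compare (2 + k) α₃ 0 1 excessˡ-α₃ excessʳ-α₃)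
                            (plethMonCoeff-compare (2 + k) α₄ 0 2 excessˡ-α₄ excessʳ-α₄)
                            (plethMonCoeff-compare (2 + k) α₅ 0 0 excessˡ-α₅ excessʳ-α₅)
                            (plethMonCoeff-compare (2 + k) α₆ 0 0 excessˡ-α₆ excessʳ-α₆) ⟩
    ℤ.suc (alternatingSum (rhs α₁) (rhs α₂) (rhs α₃) (rhs α₄) (rhs α₅) (rhs α₆))
      ≡⟨ cong ℤ.suc (sym (schurCoeff-[2+a,2+b,2] (plethMonCoeff 3 (2 + k) (3 + k)) a k)) ⟩
    ℤ.suc (plethCoeff (shape (2 + a)) (2 + k) (3 + k))
      ≡⟨ cong (λ m → ℤ.suc (plethCoeff (shape m) (2 + k) (3 + k))) (sym (square∸2 k)) ⟩
    ℤ.suc (plethCoeff (shape ((2 + k) * (2 + k) ∸ 2)) (2 + k) (3 + k)) ∎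
    where
    open ≡-Reasoning
    open Excess k
    shape : ℕ → List ℕ
    shape m = m ∷ 2 + k ∷ 2 ∷ []
    lhs rhs : Mon → ℕ
    lhs α = plethMonCoeff 3 (3 + k) (2 + k) (toList α)
    rhs α = plethMonCoeff 3 (2 + k) (3 + k) (toList α)

open import Data.Nat using (ℕ; _≤_; _∸_; _*_; zero; suc; s≤s)
open import Data.Integer using (ℤ; +_; _+_)
open import Data.List using (List; []; _∷_)
open import Relation.Binary.PropositionalEquality using (_≡_)

theorem5 : (n : ℕ) → 2 ≤ n →
    plethCoeff ((n * n ∸ 2) ∷ n ∷ 2 ∷ []) (suc n) n
    ≡ + 1 + plethCoeff ((n * n ∸ 2) ∷ n ∷ 2 ∷ []) n (suc n)
theorem5 (suc zero) (s≤s ())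
theorem5 (suc (suc k)) _ = plethCoeff-[N²-2,N,2] k
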